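{- For every $k\ge1$, the $k$-party pointer jumping function $\mathrm{Jump}_k$ is versatile.
   Context: The inputs of $\mathrm{Jump}_k$ are permutations $x_1,\dots,x_k$ of $[2k]$, player $i$ holding $x_i$, and $\mathrm{Jump}_k(x_1,\dots,x_k)=0$ iff $(x_k\circ x_{k-1}\circ\cdots\circ x_1)(1)\in[k]$. For $k$-party functions $f_1,f_2$ on $\mathcal{X}_1^k,\mathcal{X}_2^k$, $f_1\le f_2$ means there are one-to-one maps $\pi_1,\dots,\pi_k\colon\mathcal{X}_1\to\mathcal{X}_2$ with $f_1(x_1,\dots,x_k)=f_2(\pi_1(x_1),\dots,\pi_k(x_k))$ for all inputs. $g$ is flippable if $\neg g\le g$; random-self-reducible if there are maps $\pi_i(x_i,r)$ and a shared random variable $\bm r$ such that for each $z\in\{0,1\}$ and each $z$-input $(x_1,\dots,x_k)$, $(\pi_1(x_1,\bm r),\dots,\pi_k(x_k,\bm r))$ is uniform over the $z$-inputs of $g$; versatile if $\mathrm{AND}_k\le g$ ($k$-bit AND, player $i$ holding bit $i$), $g$ is flippable and random-self-reducible. -}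

module Defs where

open import Data.Bool using (Bool; true; false; not; _∧_)
open import Data.Nat using (ℕ; zero; suc; _*_; _≤_; _<_; s≤s; z≤n)
open import Data.Nat.Properties using (≤-trans; m≤n*m)
open import Data.Fin using (Fin; toℕ; fromℕ<; _<?_)
open import Data.Vec using (Vec; []; _∷_; lookup; tabulate; count; allFin; map)
open import Data.Vec.Properties using (≡-dec)
open import Data.Product using (Σ; ∃; _×_; _,_)
open import Function.Definitions using (Injective)
open import Relation.Binary.PropositionalEquality using (_≡_; refl; cong)
open import Relation.Binary.Definitions using (DecidableEquality)
open import Relation.Nullary using (does; yes; no; map′)
open import Data.Fin.Properties using (toℕ<n)

-- k-party functions.  An input is a vector (x₁,…,x_k) ∈ X^k, player i
-- holding the i-th entry; outputs are bits (false = 0, true = 1).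

KFun : ℕ → Set → Set
KFun k X = Vec X k → Bool

applyEach : ∀ {k} {X Y : Set} → (Fin k → X → Y) → Vec X k → Vec Y k
applyEach π x = tabulate (λ i → π i (lookup x i))

_≼_ : ∀ {k} {X₁ X₂ : Set} → KFun k X₁ → KFun k X₂ → Set
_≼_ {k} {X₁} {X₂} f₁ f₂ =
  Σ (Fin k → X₁ → X₂) λ π →
    (∀ i → Injective _≡_ _≡_ (π i)) ×
    (∀ x → f₁ x ≡ f₂ (applyEach π x))

AND : ∀ k → KFun k Bool
AND zero [] = true
AND (suc k) (b ∷ bs) = b ∧ AND k bs

Flippable : ∀ {k} {X : Set} → KFun k X → Set
Flippable g = (λ x → not (g x)) ≼ g

-- The shared random variable r is uniform on
-- Fin (suc m) (any finite/rational distribution reduces to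
-- this).  The distribution of (π₁(x₁,r),…,π_k(x_k,r)) is uniform over the
-- z-inputs iff it is supported on z-inputs and every z-input y is hit by
-- the same number of values r.
hits : ∀ {k m} {X : Set} → DecidableEquality X →
       (Fin k → X → Fin m → X) → Vec X k → Vec X k → ℕ
hits {m = m} _≟_ π x y =
  count (λ r → ≡-dec _≟_ (applyEach (λ i a → π i a r) x) y) (allFin m)

RandomSelfReducible : ∀ {k} {X : Set} → DecidableEquality X → KFun k X → Set
RandomSelfReducible {k} {X} _≟_ g =
  Σ ℕ λ m → Σ (Fin k → X → Fin (suc m) → X) λ π →
    ∀ (z : Bool) (x : Vec X k) → g x ≡ z →
      (∀ r → g (applyEach (λ i a → π i a r) x) ≡ z) ×
      (∀ y y′ → g y ≡ z → g y′ ≡ z → hits _≟_ π x y ≡ hits _≟_ π x y′)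

Versatile : ∀ {k} {X : Set} → DecidableEquality X → KFun k X → Set
Versatile {k} _≟_ g = (AND k ≼ g) × Flippable g × RandomSelfReducible _≟_ g

-- The injectivity
-- proof is irrelevant, so two permutations are equal iff their tables are.

record Perm (n : ℕ) : Set where
  constructor perm
  field
    table : Vec (Fin n) n
    .injective : ∀ i j → lookup table i ≡ lookup table j → i ≡ j
open Perm public

apply : ∀ {n} → Perm n → Fin n → Fin n
apply p a = lookup (table p) a

perm-≡ : ∀ {n} {p q : Perm n} → table p ≡ table q → p ≡ q
perm-≡ {p = perm t _} {q = perm .t _} refl = refl

_≟Perm_ : ∀ {n} → DecidableEquality (Perm n)
p ≟Perm q = map′ perm-≡ (cong table) (≡-dec Data.Fin._≟_ (table p) (table q))

compose : ∀ {n m} → Vec (Perm n) m → Fin n → Fin n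
compose [] a = a
compose (p ∷ ps) a = compose ps (apply p a)

-- the element 1 of [2k] (0-indexed: Fin zero), needs k ≥ 1
one : ∀ k → 1 ≤ k → Fin (2 * k)
one k k≥1 = fromℕ< {0} (≤-trans k≥1 (m≤n*m k 2))

-- Jump_k(x₁,…,x_k) = 0 iff (x_k ∘ ⋯ ∘ x₁)(1) ∈ [k] = {1,…,k}
-- (0-indexed: toℕ < k).
Jump : ∀ k → 1 ≤ k → KFun k (Perm (2 * k))
Jump k k≥1 xs with toℕ (compose xs (one k k≥1)) Data.Nat.<? k
... | yes _ = false
... | no _ = true

module Submission where

-- Everything is read off the pointer p(x) = (x_k ∘ ⋯ ∘ x₁)(1): Jump_k(x) = 0
-- iff p(x) lies in the lower half [k] of [2k] (Jump-isLow).
--  * AND ≤ Jump: on bit 1 player i plays the transposition (i i+1), on bit 0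
--    the identity, so the pointer climbs from 1 to k + 1 iff all bits are 1.
--  * Flippable: the last player also reverses [2k], exchanging the halves.
--  * Random self-reducibility: a gauge g = (g₀, …, g_k) acts on inputs by
--    x_i ↦ g_i ∘ x_i ∘ g_{i-1}⁻¹, which conjugates the walk by g₀ and g_k.
--    The gauges with g₀ fixing 1 and g_k preserving the halves form a group
--    that leaves Jump_k invariant and acts transitively on each fibre of
--    Jump_k, so a uniformly random such gauge hits all inputs of a fibre
--    equally often (counted over a duplicate-free list of the group).

open import Defs
open import Data.Bool as Bool using (Bool; true; false; not; _∧_)
open import Data.Bool.Properties using (not-injective; not-involutive; ∧-assoc; ∧-identityʳ)
open import Data.Nat using (ℕ; zero; suc; _+_; _*_; _∸_; _≤_; _<_; s≤s; z≤n; _<?_)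
import Data.Nat.Properties as ℕP
open import Data.Fin as Fin using (Fin; toℕ; opposite; punchOut; inject₁; inject≤; fromℕ)
open import Data.Fin.Properties as FinP using (any?; injective⇒≤; punchOut-injective)
open import Data.Fin.Permutation.Components using (transpose; transpose-inverse)
open import Data.Vec as Vec using (Vec; []; _∷_; lookup; tabulate)
open import Data.Vec.Properties as VecP using (lookup∘tabulate; tabulate∘lookup; tabulate-cong)
open import Data.List as List using (List; []; _∷_; length; filter)
open import Data.List.Properties using (tabulate-lookup; filter-≐)
open import Data.List.Membership.Propositional using (_∈_)
open import Data.List.Membership.Propositional.Properties
  using (∈-map⁺; ∈-map⁻; ∈-lookup; ∈-filter⁺; ∈-filter⁻; ∈-cartesianProductWith⁺; ∈-allFin;
         ∈-deduplicate⁺; ∈-deduplicate⁻)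
open import Data.List.Membership.Propositional.Properties.WithK using (unique∧set⇒bag)
open import Data.List.Relation.Binary.BagAndSetEquality using (∼bag⇒↭)
open import Data.List.Relation.Binary.Permutation.Propositional using (_↭_)
open import Data.List.Relation.Binary.Permutation.Propositional.Properties using (filter-↭; ↭-length)
open import Data.List.Relation.Unary.Any using (here)
open import Data.List.Relation.Unary.Unique.Propositional using (Unique)
import Data.List.Relation.Unary.Unique.Propositional.Properties as UniqueP
open import Data.List.Relation.Unary.Unique.DecPropositional.Properties using (deduplicate-!)
open import Data.Product using (Σ; ∃; _×_; _,_; proj₁; proj₂)
open import Function.Bundles using (mk⇔)
open import Function using (_∘_; id)
open import Function.Definitions using (Injective)
open import Relation.Binary.PropositionalEquality
open import Relation.Binary.Definitions using (DecidableEquality)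
open import Relation.Nullary using (Dec; does; yes; no; ¬_; contradiction)
open import Relation.Nullary.Decidable using (recompute; dec-true; dec-false; _×-dec_; _→-dec_)
open import Relation.Unary using (Decidable)

-- Permutations of Fin n form a group

module _ {n : ℕ} where

  mkPerm : (f : Fin n → Fin n) → .(∀ i j → f i ≡ f j → i ≡ j) → Perm n
  mkPerm f f-inj = perm (tabulate f) λ i j e →
    f-inj i j (trans (sym (lookup∘tabulate f i)) (trans e (lookup∘tabulate f j)))

  perm-ext : {p q : Perm n} → (∀ a → apply p a ≡ apply q a) → p ≡ q
  perm-ext {p} {q} p≗q = perm-≡ (begin
    table p             ≡⟨ tabulate∘lookup (table p) ⟨
    tabulate (apply p)  ≡⟨ tabulate-cong p≗q ⟩
    tabulate (apply q)  ≡⟨ tabulate∘lookup (table q) ⟩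
    table q             ∎)
    where open ≡-Reasoning

  apply-injective : (p : Perm n) → Injective _≡_ _≡_ (apply p)
  apply-injective (perm t t-inj) {i} {j} e = recompute (i Fin.≟ j) (t-inj i j e)

-- An injective self-map of Fin n is onto: otherwise it would squeeze
-- Fin n injectively into Fin (n - 1).
injective⇒surjective : ∀ {n} (f : Fin n → Fin n) → Injective _≡_ _≡_ f →
  ∀ b → ∃ λ a → f a ≡ b
injective⇒surjective {suc n} f f-inj b with any? (λ a → f a Fin.≟ b)
... | yes hit = hit
... | no miss = contradiction (injective⇒≤ squeeze-injective) ℕP.1+n≰n
  where
  squeeze : Fin (suc n) → Fin n
  squeeze a = punchOut (λ fa≡b → miss (a , sym fa≡b))
  squeeze-injective : Injective _≡_ _≡_ squeeze
  squeeze-injective {a} {a′} e =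
    f-inj (punchOut-injective (λ e′ → miss (a , sym e′)) (λ e′ → miss (a′ , sym e′)) e)

module _ {n : ℕ} where

  idP : Perm n
  idP = mkPerm id (λ _ _ e → e)

  _∙_ : Perm n → Perm n → Perm n
  p ∙ q = mkPerm (apply p ∘ apply q) (λ i j e → apply-injective q (apply-injective p e))

  preimage : Perm n → Fin n → Fin n
  preimage p b = proj₁ (injective⇒surjective (apply p) (apply-injective p) b)

  apply-preimage : ∀ p b → apply p (preimage p b) ≡ b
  apply-preimage p b = proj₂ (injective⇒surjective (apply p) (apply-injective p) b)

  inv : Perm n → Perm n
  inv p = mkPerm (preimage p) λ i j e →
    trans (sym (apply-preimage p i)) (trans (cong (apply p) e) (apply-preimage p j))

  apply-id : ∀ a → apply idP a ≡ a
  apply-id = lookup∘tabulate id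

  apply-∙ : ∀ p q a → apply (p ∙ q) a ≡ apply p (apply q a)
  apply-∙ p q = lookup∘tabulate (apply p ∘ apply q)

  apply-inv-r : ∀ p b → apply p (apply (inv p) b) ≡ b
  apply-inv-r p b = trans (cong (apply p) (lookup∘tabulate (preimage p) b)) (apply-preimage p b)

  apply-inv-l : ∀ p a → apply (inv p) (apply p a) ≡ a
  apply-inv-l p a = apply-injective p (apply-inv-r p (apply p a))

  ∙-assoc : ∀ p q r → (p ∙ q) ∙ r ≡ p ∙ (q ∙ r)
  ∙-assoc p q r = perm-ext λ a → begin
    apply ((p ∙ q) ∙ r) a          ≡⟨ apply-∙ (p ∙ q) r a ⟩
    apply (p ∙ q) (apply r a)      ≡⟨ apply-∙ p q (apply r a) ⟩
    apply p (apply q (apply r a))  ≡⟨ cong (apply p) (apply-∙ q r a) ⟨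
    apply p (apply (q ∙ r) a)      ≡⟨ apply-∙ p (q ∙ r) a ⟨
    apply (p ∙ (q ∙ r)) a          ∎
    where open ≡-Reasoning

  ∙-identityˡ : ∀ p → idP ∙ p ≡ p
  ∙-identityˡ p = perm-ext λ a → trans (apply-∙ idP p a) (apply-id (apply p a))

  ∙-identityʳ : ∀ p → p ∙ idP ≡ p
  ∙-identityʳ p = perm-ext λ a → trans (apply-∙ p idP a) (cong (apply p) (apply-id a))

  ∙-inverseˡ : ∀ p → inv p ∙ p ≡ idP
  ∙-inverseˡ p = perm-ext λ a →
    trans (apply-∙ (inv p) p a) (trans (apply-inv-l p a) (sym (apply-id a)))

  ∙-inverseʳ : ∀ p → p ∙ inv p ≡ idP
  ∙-inverseʳ p = perm-ext λ a →
    trans (apply-∙ p (inv p) a) (trans (apply-inv-r p a) (sym (apply-id a)))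

  inv-∙ : ∀ p q → inv (p ∙ q) ≡ inv q ∙ inv p
  inv-∙ p q = perm-ext λ a → apply-injective (p ∙ q) (begin
    apply (p ∙ q) (apply (inv (p ∙ q)) a)                ≡⟨ apply-inv-r (p ∙ q) a ⟩
    a                                                    ≡⟨ apply-inv-r p a ⟨
    apply p (apply (inv p) a)                            ≡⟨ cong (apply p) (apply-inv-r q _) ⟨
    apply p (apply q (apply (inv q) (apply (inv p) a)))  ≡⟨ apply-∙ p q _ ⟨
    apply (p ∙ q) (apply (inv q) (apply (inv p) a))      ≡⟨ cong (apply (p ∙ q)) (apply-∙ (inv q) (inv p) a) ⟨
    apply (p ∙ q) (apply (inv q ∙ inv p) a)              ∎)
    where open ≡-Reasoning

  inv-id : inv idP ≡ idP
  inv-id = trans (sym (∙-identityʳ (inv idP))) (∙-inverseˡ idP)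

  cancel-invˡ : ∀ p q → inv p ∙ (p ∙ q) ≡ q
  cancel-invˡ p q = begin
    inv p ∙ (p ∙ q)  ≡⟨ ∙-assoc (inv p) p q ⟨
    (inv p ∙ p) ∙ q  ≡⟨ cong (_∙ q) (∙-inverseˡ p) ⟩
    idP ∙ q          ≡⟨ ∙-identityˡ q ⟩
    q                ∎
    where open ≡-Reasoning

  cancel-invʳ : ∀ p q → p ∙ (inv p ∙ q) ≡ q
  cancel-invʳ p q = begin
    p ∙ (inv p ∙ q)  ≡⟨ ∙-assoc p (inv p) q ⟨
    (p ∙ inv p) ∙ q  ≡⟨ cong (_∙ q) (∙-inverseʳ p) ⟩
    idP ∙ q          ≡⟨ ∙-identityˡ q ⟩
    q                ∎
    where open ≡-Reasoning

  ∙-cancelˡ : ∀ p {q r} → p ∙ q ≡ p ∙ r → q ≡ r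
  ∙-cancelˡ p {q} {r} e =
    trans (sym (cancel-invˡ p q)) (trans (cong (inv p ∙_) e) (cancel-invˡ p r))

  swap : Fin n → Fin n → Perm n
  swap a b = mkPerm (transpose a b) λ i j e →
    trans (sym (transpose-inverse b a)) (trans (cong (transpose b a) e) (transpose-inverse b a))

  swap-left : ∀ a b → apply (swap a b) a ≡ b
  swap-left a b rewrite lookup∘tabulate (transpose a b) a | dec-true (a Fin.≟ a) refl = refl

  swap-right : ∀ a b → apply (swap a b) b ≡ a
  swap-right a b rewrite lookup∘tabulate (transpose a b) b with b Fin.≟ a
  ... | yes b≡a = b≡a
  ... | no _ rewrite dec-true (b Fin.≟ b) refl = refl

  swap-other : ∀ a b c → c ≢ a → c ≢ b → apply (swap a b) c ≡ c
  swap-other a b c c≢a c≢b rewrite lookup∘tabulate (transpose a b) c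
    | dec-false (c Fin.≟ a) c≢a | dec-false (c Fin.≟ b) c≢b = refl

module _ {n : ℕ} where

  Fixes : Fin n → Perm n → Set
  Fixes a p = apply p a ≡ a

  fixes-id : ∀ a → Fixes a idP
  fixes-id = apply-id

  fixes-∙ : ∀ {a} p q → Fixes a p → Fixes a q → Fixes a (p ∙ q)
  fixes-∙ p q p-fix q-fix = trans (apply-∙ p q _) (trans (cong (apply p) q-fix) p-fix)

  fixes-inv : ∀ {a} p → Fixes a p → Fixes a (inv p)
  fixes-inv {a} p p-fix = trans (cong (apply (inv p)) (sym p-fix)) (apply-inv-l p a)

  Preserves : (Fin n → Bool) → Perm n → Set
  Preserves χ p = ∀ c → χ (apply p c) ≡ χ c

  preserves? : ∀ χ p → Dec (Preserves χ p)
  preserves? χ p = FinP.all? λ c → χ (apply p c) Bool.≟ χ c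

  preserves-id : ∀ χ → Preserves χ idP
  preserves-id χ c = cong χ (apply-id c)

  preserves-∙ : ∀ {χ} p q → Preserves χ p → Preserves χ q → Preserves χ (p ∙ q)
  preserves-∙ {χ} p q p-pres q-pres c =
    trans (cong χ (apply-∙ p q c)) (trans (p-pres (apply q c)) (q-pres c))

  preserves-inv : ∀ {χ} p → Preserves χ p → Preserves χ (inv p)
  preserves-inv {χ} p p-pres c =
    trans (sym (p-pres (apply (inv p) c))) (cong χ (apply-inv-r p c))

  preserves-swap : ∀ χ a b → χ a ≡ χ b → Preserves χ (swap a b)
  preserves-swap χ a b χa≡χb c with c Fin.≟ a | c Fin.≟ b
  ... | yes refl | _ = trans (cong χ (swap-left c b)) (sym χa≡χb)
  ... | no _ | yes refl = trans (cong χ (swap-right a c)) χa≡χb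
  ... | no c≢a | no c≢b = cong χ (swap-other a b c c≢a c≢b)

compose-induction : ∀ {N} (P : ℕ → Fin N → Set) {m} (xs : Vec (Perm N) m) {a} → P 0 a →
  (∀ (i : Fin m) {c} → P (toℕ i) c → P (suc (toℕ i)) (apply (lookup xs i) c)) →
  P m (compose xs a)
compose-induction P [] P0 step = P0
compose-induction P (x ∷ xs) P0 step =
  compose-induction (P ∘ suc) xs (step Fin.zero P0) (step ∘ Fin.suc)

composite : ∀ {N j} → Vec (Perm N) j → Perm N
composite [] = idP
composite (x ∷ xs) = composite xs ∙ x

apply-composite : ∀ {N j} (xs : Vec (Perm N) j) a → apply (composite xs) a ≡ compose xs a
apply-composite [] a = apply-id a
apply-composite (x ∷ xs) a = trans (apply-∙ (composite xs) x a) (apply-composite xs (apply x a))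

onLast : ∀ {m} {A : Set} → (A → A) → Fin (suc m) → A → A
onLast {zero} f Fin.zero = f
onLast {suc m} f Fin.zero = id
onLast {suc m} f (Fin.suc i) = onLast f i

onLast-injective : ∀ {m} {A : Set} {f : A → A} → Injective _≡_ _≡_ f →
  ∀ i → Injective _≡_ _≡_ (onLast {m} f i)
onLast-injective {zero} f-inj Fin.zero = f-inj
onLast-injective {suc m} f-inj Fin.zero = id
onLast-injective {suc m} f-inj (Fin.suc i) = onLast-injective f-inj i

compose-onLast : ∀ {N m} (f : Perm N) (xs : Vec (Perm N) (suc m)) a →
  compose (applyEach (onLast (f ∙_)) xs) a ≡ apply f (compose xs a)
compose-onLast {m = zero} f (x ∷ []) a = apply-∙ f x a
compose-onLast {m = suc m} f (x ∷ xs) a = compose-onLast f xs (apply x a)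

-- Gauges acting on inputs

module GaugeAction {N : ℕ} where

  Gauge : ℕ → Set
  Gauge j = Vec (Perm N) (suc j)

  first : ∀ {j} → Gauge j → Perm N
  first g = lookup g Fin.zero

  last : ∀ {j} → Gauge j → Perm N
  last {j} g = lookup g (fromℕ j)

  actOn : ∀ {j} → Gauge j → Fin j → Perm N → Perm N
  actOn g i x = lookup g (Fin.suc i) ∙ (x ∙ inv (lookup g (inject₁ i)))

  act : ∀ {j} → Gauge j → Vec (Perm N) j → Vec (Perm N) j
  act g = applyEach (actOn g)

  compose-act : ∀ {j} (g : Gauge j) x a →
    compose (act g x) a ≡ apply (last g) (compose x (apply (inv (first g)) a))
  compose-act (g₀ ∷ []) [] a = sym (apply-inv-r g₀ a)
  compose-act (g₀ ∷ g₁ ∷ gs) (x ∷ xs) a =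
    trans (compose-act (g₁ ∷ gs) xs (apply (g₁ ∙ (x ∙ inv g₀)) a))
          (cong (λ b → apply (last (g₁ ∷ gs)) (compose xs b)) unconjugate)
    where
    open ≡-Reasoning
    unconjugate : apply (inv g₁) (apply (g₁ ∙ (x ∙ inv g₀)) a) ≡ apply x (apply (inv g₀) a)
    unconjugate = begin
      apply (inv g₁) (apply (g₁ ∙ (x ∙ inv g₀)) a)      ≡⟨ cong (apply (inv g₁)) (apply-∙ g₁ (x ∙ inv g₀) a) ⟩
      apply (inv g₁) (apply g₁ (apply (x ∙ inv g₀) a))  ≡⟨ apply-inv-l g₁ (apply (x ∙ inv g₀) a) ⟩
      apply (x ∙ inv g₀) a                              ≡⟨ apply-∙ x (inv g₀) a ⟩
      apply x (apply (inv g₀) a)                        ∎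

  _⊗_ : ∀ {n} → Vec (Perm N) n → Vec (Perm N) n → Vec (Perm N) n
  _⊗_ = Vec.zipWith _∙_

  gauge-inv : ∀ {n} → Vec (Perm N) n → Vec (Perm N) n
  gauge-inv = Vec.map inv

  gauge-id : ∀ {n} → Vec (Perm N) n
  gauge-id = Vec.replicate _ idP

  ⊗-inverseˡ : ∀ {n} (h : Vec (Perm N) n) → gauge-inv h ⊗ h ≡ gauge-id
  ⊗-inverseˡ [] = refl
  ⊗-inverseˡ (h ∷ hs) = cong₂ _∷_ (∙-inverseˡ h) (⊗-inverseˡ hs)

  ⊗-cancel-invˡ : ∀ {n} (h g : Vec (Perm N) n) → gauge-inv h ⊗ (h ⊗ g) ≡ g
  ⊗-cancel-invˡ [] [] = refl
  ⊗-cancel-invˡ (h ∷ hs) (g ∷ gs) = cong₂ _∷_ (cancel-invˡ h g) (⊗-cancel-invˡ hs gs)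

  ⊗-cancel-invʳ : ∀ {n} (h g : Vec (Perm N) n) → h ⊗ (gauge-inv h ⊗ g) ≡ g
  ⊗-cancel-invʳ [] [] = refl
  ⊗-cancel-invʳ (h ∷ hs) (g ∷ gs) = cong₂ _∷_ (cancel-invʳ h g) (⊗-cancel-invʳ hs gs)

  conjugate-∙ : ∀ (h₀ h₁ g₀ g₁ x : Perm N) →
    (h₁ ∙ g₁) ∙ (x ∙ inv (h₀ ∙ g₀)) ≡ h₁ ∙ ((g₁ ∙ (x ∙ inv g₀)) ∙ inv h₀)
  conjugate-∙ h₀ h₁ g₀ g₁ x = begin
    (h₁ ∙ g₁) ∙ (x ∙ inv (h₀ ∙ g₀))      ≡⟨ cong (λ p → (h₁ ∙ g₁) ∙ (x ∙ p)) (inv-∙ h₀ g₀) ⟩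
    (h₁ ∙ g₁) ∙ (x ∙ (inv g₀ ∙ inv h₀))  ≡⟨ ∙-assoc h₁ g₁ (x ∙ (inv g₀ ∙ inv h₀)) ⟩
    h₁ ∙ (g₁ ∙ (x ∙ (inv g₀ ∙ inv h₀)))  ≡⟨ cong (λ p → h₁ ∙ (g₁ ∙ p)) (∙-assoc x (inv g₀) (inv h₀)) ⟨
    h₁ ∙ (g₁ ∙ ((x ∙ inv g₀) ∙ inv h₀))  ≡⟨ cong (h₁ ∙_) (∙-assoc g₁ (x ∙ inv g₀) (inv h₀)) ⟨
    h₁ ∙ ((g₁ ∙ (x ∙ inv g₀)) ∙ inv h₀)  ∎
    where open ≡-Reasoning

  act-⊗ : ∀ {j} (h g : Gauge j) x → act (h ⊗ g) x ≡ act h (act g x)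
  act-⊗ (h₀ ∷ []) (g₀ ∷ []) [] = refl
  act-⊗ (h₀ ∷ h₁ ∷ hs) (g₀ ∷ g₁ ∷ gs) (x ∷ xs) =
    cong₂ _∷_ (conjugate-∙ h₀ h₁ g₀ g₁ x) (act-⊗ (h₁ ∷ hs) (g₁ ∷ gs) xs)

  act-id : ∀ {j} (x : Vec (Perm N) j) → act gauge-id x ≡ x
  act-id [] = refl
  act-id (x ∷ xs) = cong₂ _∷_ (begin
    idP ∙ (x ∙ inv idP)  ≡⟨ ∙-identityˡ (x ∙ inv idP) ⟩
    x ∙ inv idP          ≡⟨ cong (x ∙_) inv-id ⟩
    x ∙ idP              ≡⟨ ∙-identityʳ x ⟩
    x                    ∎) (act-id xs)
    where open ≡-Reasoning

  act-injective : ∀ {j} (h : Gauge j) {x y} → act h x ≡ act h y → x ≡ y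
  act-injective h {x} {y} e = begin
    x                            ≡⟨ act-id x ⟨
    act gauge-id x               ≡⟨ cong (λ g → act g x) (⊗-inverseˡ h) ⟨
    act (gauge-inv h ⊗ h) x      ≡⟨ act-⊗ (gauge-inv h) h x ⟩
    act (gauge-inv h) (act h x)  ≡⟨ cong (act (gauge-inv h)) e ⟩
    act (gauge-inv h) (act h y)  ≡⟨ act-⊗ (gauge-inv h) h y ⟨
    act (gauge-inv h ⊗ h) y      ≡⟨ cong (λ g → act g y) (⊗-inverseˡ h) ⟩
    act gauge-id y               ≡⟨ act-id y ⟩
    y                            ∎
    where open ≡-Reasoning

  -- build h y y′ is the gauge with first entry h that carries y to y′;
  -- each further entry is forced by the previous one.
  build : ∀ {j} → Perm N → Vec (Perm N) j → Vec (Perm N) j → Gauge j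
  buildRest : ∀ {j} → Perm N → Vec (Perm N) j → Vec (Perm N) j → Vec (Perm N) j
  build h ys ys′ = h ∷ buildRest h ys ys′
  buildRest h [] [] = []
  buildRest h (y ∷ ys) (y′ ∷ ys′) = build (y′ ∙ (h ∙ inv y)) ys ys′

  transport-cancel : ∀ (h y y′ : Perm N) → (y′ ∙ (h ∙ inv y)) ∙ (y ∙ inv h) ≡ y′
  transport-cancel h y y′ = begin
    (y′ ∙ (h ∙ inv y)) ∙ (y ∙ inv h)  ≡⟨ ∙-assoc y′ (h ∙ inv y) (y ∙ inv h) ⟩
    y′ ∙ ((h ∙ inv y) ∙ (y ∙ inv h))  ≡⟨ cong (y′ ∙_) (∙-assoc h (inv y) (y ∙ inv h)) ⟩
    y′ ∙ (h ∙ (inv y ∙ (y ∙ inv h)))  ≡⟨ cong (λ p → y′ ∙ (h ∙ p)) (cancel-invˡ y (inv h)) ⟩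
    y′ ∙ (h ∙ inv h)                  ≡⟨ cong (y′ ∙_) (∙-inverseʳ h) ⟩
    y′ ∙ idP                          ≡⟨ ∙-identityʳ y′ ⟩
    y′                                ∎
    where open ≡-Reasoning

  build-act : ∀ {j} h (ys ys′ : Vec (Perm N) j) → act (build h ys ys′) ys ≡ ys′
  build-act h [] [] = refl
  build-act h (y ∷ ys) (y′ ∷ ys′) =
    cong₂ _∷_ (transport-cancel h y y′) (build-act (y′ ∙ (h ∙ inv y)) ys ys′)

  build-last : ∀ {j} h (ys ys′ : Vec (Perm N) j) b →
    apply (last (build h ys ys′)) (compose ys b) ≡ compose ys′ (apply h b)
  build-last h [] [] b = refl
  build-last h (y ∷ ys) (y′ ∷ ys′) b =
    trans (build-last (y′ ∙ (h ∙ inv y)) ys ys′ (apply y b)) (cong (compose ys′) (begin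
      apply (y′ ∙ (h ∙ inv y)) (apply y b)            ≡⟨ apply-∙ y′ (h ∙ inv y) (apply y b) ⟩
      apply y′ (apply (h ∙ inv y) (apply y b))        ≡⟨ cong (apply y′) (apply-∙ h (inv y) (apply y b)) ⟩
      apply y′ (apply h (apply (inv y) (apply y b)))  ≡⟨ cong (apply y′ ∘ apply h) (apply-inv-l y b) ⟩
      apply y′ (apply h b)                            ∎))
    where open ≡-Reasoning

module Admissible {N : ℕ} (χ : Fin N → Bool) (o : Fin N) where
  open GaugeAction {N}

  Admissible : ∀ {j} → Gauge j → Set
  Admissible g = Fixes o (first g) × Preserves χ (last g)

  admissible? : ∀ {j} (g : Gauge j) → Dec (Admissible g)
  admissible? g = (apply (first g) o Fin.≟ o) ×-dec preserves? χ (last g)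

  admissible-id : ∀ {j} → Admissible (gauge-id {suc j})
  admissible-id {j} = fixes-id o ,
    subst (Preserves χ) (sym (VecP.lookup-replicate (fromℕ j) idP)) (preserves-id χ)

  admissible-⊗ : ∀ {j} (h g : Gauge j) → Admissible h → Admissible g → Admissible (h ⊗ g)
  admissible-⊗ {j} h@(h₀ ∷ _) g@(g₀ ∷ _) (h-fix , h-pres) (g-fix , g-pres) =
    fixes-∙ h₀ g₀ h-fix g-fix ,
    subst (Preserves χ) (sym (VecP.lookup-zipWith _∙_ (fromℕ j) h g))
      (preserves-∙ (last h) (last g) h-pres g-pres)

  admissible-inv : ∀ {j} (h : Gauge j) → Admissible h → Admissible (gauge-inv h)
  admissible-inv {j} h@(h₀ ∷ _) (h-fix , h-pres) =
    fixes-inv h₀ h-fix ,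
    subst (Preserves χ) (sym (VecP.lookup-map (fromℕ j) inv h)) (preserves-inv (last h) h-pres)

  colour-invariant : ∀ {j} (g : Gauge j) x → Admissible g →
    χ (compose (act g x) o) ≡ χ (compose x o)
  colour-invariant g x (g-fix , g-pres) = begin
    χ (compose (act g x) o)                                   ≡⟨ cong χ (compose-act g x o) ⟩
    χ (apply (last g) (compose x (apply (inv (first g)) o)))  ≡⟨ cong (λ a → χ (apply (last g) (compose x a)))
                                                                   (fixes-inv (first g) g-fix) ⟩
    χ (apply (last g) (compose x o))                          ≡⟨ g-pres (compose x o) ⟩
    χ (compose x o)                                           ∎
    where open ≡-Reasoning

  -- With C, C′ the walks through y, y′ and τ the swap of their end points,
  -- the gauge build (C′⁻¹ τ C) y y′ is admissible: its first entry fixes o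
  -- and its last entry is τ.
  transitive : ∀ {j} (y y′ : Vec (Perm N) j) → χ (compose y o) ≡ χ (compose y′ o) →
    Σ (Gauge j) λ g → Admissible g × act g y ≡ y′
  transitive y y′ same-colour = build h y y′ , (h-fixes , last-preserves) , build-act h y y′
    where
    open ≡-Reasoning
    C = composite y
    C′ = composite y′
    τ = swap (apply C o) (apply C′ o)
    h = inv C′ ∙ (τ ∙ C)

    h-fixes : Fixes o h
    h-fixes = begin
      apply (inv C′ ∙ (τ ∙ C)) o            ≡⟨ apply-∙ (inv C′) (τ ∙ C) o ⟩
      apply (inv C′) (apply (τ ∙ C) o)      ≡⟨ cong (apply (inv C′)) (apply-∙ τ C o) ⟩
      apply (inv C′) (apply τ (apply C o))  ≡⟨ cong (apply (inv C′)) (swap-left (apply C o) (apply C′ o)) ⟩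
      apply (inv C′) (apply C′ o)           ≡⟨ apply-inv-l C′ o ⟩
      o                                     ∎

    last-is-τ : last (build h y y′) ≡ τ
    last-is-τ = perm-ext λ d → let b = apply (inv C) d; L = last (build h y y′) in begin
      apply L d                                    ≡⟨ cong (apply L) (apply-inv-r C d) ⟨
      apply L (apply C b)                          ≡⟨ cong (apply L) (apply-composite y b) ⟩
      apply L (compose y b)                        ≡⟨ build-last h y y′ b ⟩
      compose y′ (apply h b)                       ≡⟨ apply-composite y′ (apply h b) ⟨
      apply C′ (apply h b)                         ≡⟨ cong (apply C′) (apply-∙ (inv C′) (τ ∙ C) b) ⟩
      apply C′ (apply (inv C′) (apply (τ ∙ C) b))  ≡⟨ apply-inv-r C′ (apply (τ ∙ C) b) ⟩
      apply (τ ∙ C) b                              ≡⟨ apply-∙ τ C b ⟩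
      apply τ (apply C b)                          ≡⟨ cong (apply τ) (apply-inv-r C d) ⟩
      apply τ d                                    ∎

    end-points-same-colour : χ (apply C o) ≡ χ (apply C′ o)
    end-points-same-colour = begin
      χ (apply C o)     ≡⟨ cong χ (apply-composite y o) ⟩
      χ (compose y o)   ≡⟨ same-colour ⟩
      χ (compose y′ o)  ≡⟨ cong χ (apply-composite y′ o) ⟨
      χ (apply C′ o)    ∎

    last-preserves : Preserves χ (last (build h y y′))
    last-preserves = subst (Preserves χ) (sym last-is-τ)
      (preserves-swap χ (apply C o) (apply C′ o) end-points-same-colour)

Complete : {A : Set} → List A → Set
Complete xs = ∀ a → a ∈ xs

vectors : ∀ {A : Set} → List A → (j : ℕ) → List (Vec A j)
vectors xs zero = [] ∷ []
vectors xs (suc j) = List.cartesianProductWith _∷_ xs (vectors xs j)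

vectors-complete : ∀ {A : Set} {xs : List A} → Complete xs → ∀ j → Complete (vectors xs j)
vectors-complete xs-complete zero [] = here refl
vectors-complete xs-complete (suc j) (a ∷ v) =
  ∈-cartesianProductWith⁺ _∷_ (xs-complete a) (vectors-complete xs-complete j v)

module _ {n : ℕ} where

  InjectiveTable : Vec (Fin n) n → Set
  InjectiveTable t = ∀ i j → lookup t i ≡ lookup t j → i ≡ j

  injectiveTable? : ∀ t → Dec (InjectiveTable t)
  injectiveTable? t = FinP.all? λ i → FinP.all? λ j →
    (lookup t i Fin.≟ lookup t j) →-dec (i Fin.≟ j)

  -- reads a table as a permutation (non-injective tables give the identity)
  toPerm : Vec (Fin n) n → Perm n
  toPerm t with injectiveTable? t
  ... | yes t-inj = perm t t-inj
  ... | no _ = idP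

  toPerm-table : ∀ p → toPerm (table p) ≡ p
  toPerm-table p@(perm t _) with injectiveTable? t
  ... | yes _ = refl
  ... | no ¬inj = contradiction (λ i j e → apply-injective p e) ¬inj

permutations : ∀ n → List (Perm n)
permutations n = List.map toPerm (vectors (List.allFin n) n)

permutations-complete : ∀ n → Complete (permutations n)
permutations-complete n p = subst (_∈ permutations n) (toPerm-table p)
  (∈-map⁺ toPerm (vectors-complete ∈-allFin n (table p)))

length-filter-map : ∀ {A B : Set} {P : B → Set} (P? : Decidable P) (f : A → B) xs →
  length (filter P? (List.map f xs)) ≡ length (filter (P? ∘ f) xs)
length-filter-map P? f [] = refl
length-filter-map P? f (x ∷ xs) with does (P? (f x))
... | true = cong suc (length-filter-map P? f xs)
... | false = length-filter-map P? f xs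

-- Counting over a duplicate-free list is invariant under any injection φ
-- that maps the list onto itself, since then map φ L is a permutation of L.
count-invariant : ∀ {A : Set} {P : A → Set} (P? : Decidable P) {L : List A} (φ : A → A) →
  Unique L → Injective _≡_ _≡_ φ →
  (∀ {a} → a ∈ L → φ a ∈ L) → (∀ {a} → a ∈ L → ∃ λ b → b ∈ L × φ b ≡ a) →
  length (filter P? L) ≡ length (filter (P? ∘ φ) L)
count-invariant P? {L} φ L-unique φ-injective φ-into φ-onto = begin
  length (filter P? L)               ≡⟨ ↭-length (filter-↭ P? φL↭L) ⟨
  length (filter P? (List.map φ L))  ≡⟨ length-filter-map P? φ L ⟩
  length (filter (P? ∘ φ) L)         ∎
  where
  open ≡-Reasoning
  into : ∀ {a} → a ∈ List.map φ L → a ∈ L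
  into a∈φL with b , b∈L , refl ← ∈-map⁻ φ a∈φL = φ-into b∈L
  onto : ∀ {a} → a ∈ L → a ∈ List.map φ L
  onto a∈L with b , b∈L , refl ← φ-onto a∈L = ∈-map⁺ φ b∈L
  φL↭L : List.map φ L ↭ L
  φL↭L = ∼bag⇒↭ (unique∧set⇒bag (UniqueP.map⁺ φ-injective L-unique) L-unique (mk⇔ into onto))

count-tabulate : ∀ {n} {A B : Set} {P : A → Set} (P? : Decidable P) (f : B → A) (g : Fin n → B) →
  Vec.count (λ r → P? (f r)) (tabulate g) ≡ length (filter P? (List.tabulate (f ∘ g)))
count-tabulate {zero} P? f g = refl
count-tabulate {suc n} P? f g with does (P? (f (g Fin.zero)))
... | true = cong suc (count-tabulate P? f (g ∘ Fin.suc))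
... | false = count-tabulate P? f (g ∘ Fin.suc)

-- Random self-reducibility of functions of the colour of the end point

-- If f(x) is determined by, and determines, the colour under χ of the end
-- point of the walk through x from o, then f is random self-reducible:
-- apply a uniformly random admissible gauge.  The result stays in the
-- fibre of f(x) by colour-invariant, and all y in that fibre are hit
-- equally often, since left multiplication by a gauge carrying y to y′
-- (transitive) permutes the admissible gauges.
module ColourRSR {N j : ℕ} (χ : Fin N → Bool) (o : Fin N) (f : KFun j (Perm N))
  (f-respects : ∀ x y → χ (compose x o) ≡ χ (compose y o) → f x ≡ f y)
  (f-reflects : ∀ x y → f x ≡ f y → χ (compose x o) ≡ χ (compose y o)) where

  open GaugeAction {N}
  open Admissible χ o

  _≟Gauge_ : DecidableEquality (Gauge j)
  _≟Gauge_ = VecP.≡-dec _≟Perm_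

  candidates : List (Gauge j)
  candidates = filter admissible? (vectors (permutations N) (suc j))

  gauges : List (Gauge j)
  gauges = List.deduplicate _≟Gauge_ candidates

  gauges-sound : ∀ {g} → g ∈ gauges → Admissible g
  gauges-sound g∈ = proj₂ (∈-filter⁻ admissible? {xs = vectors (permutations N) (suc j)}
    (∈-deduplicate⁻ _≟Gauge_ candidates g∈))

  gauges-complete : ∀ {g} → Admissible g → g ∈ gauges
  gauges-complete {g} g-adm = ∈-deduplicate⁺ _≟Gauge_
    (∈-filter⁺ admissible? (vectors-complete (permutations-complete N) (suc j) g) g-adm)

  hit? : ∀ x y (g : Gauge j) → Dec (act g x ≡ y)
  hit? x y g = VecP.≡-dec _≟Perm_ (act g x) y

  hitCount : List (Gauge j) → Vec (Perm N) j → Vec (Perm N) j → ℕ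
  hitCount L x y = length (filter (hit? x y) L)

  hitCount-uniform : ∀ x y y′ → f y ≡ f y′ → hitCount gauges x y ≡ hitCount gauges x y′
  hitCount-uniform x y y′ fy≡fy′ with h , h-adm , hy≡y′ ← transitive y y′ (f-reflects y y′ fy≡fy′) =
    begin
      length (filter (hit? x y) gauges)
        ≡⟨ cong length (filter-≐ (hit? x y) (hit? x y′ ∘ (h ⊗_)) (forward , backward) gauges) ⟩
      length (filter (hit? x y′ ∘ (h ⊗_)) gauges)
        ≡⟨ count-invariant (hit? x y′) (h ⊗_) (deduplicate-! _≟Gauge_ candidates) ⊗-injective into onto ⟨
      length (filter (hit? x y′) gauges)
        ∎
    where
    open ≡-Reasoning
    forward : ∀ {g} → act g x ≡ y → act (h ⊗ g) x ≡ y′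
    forward {g} gx≡y = trans (act-⊗ h g x) (trans (cong (act h) gx≡y) hy≡y′)
    backward : ∀ {g} → act (h ⊗ g) x ≡ y′ → act g x ≡ y
    backward {g} hgx≡y′ = act-injective h (trans (sym (act-⊗ h g x)) (trans hgx≡y′ (sym hy≡y′)))
    ⊗-injective : Injective _≡_ _≡_ (h ⊗_)
    ⊗-injective {g} {g′} e =
      trans (sym (⊗-cancel-invˡ h g)) (trans (cong (gauge-inv h ⊗_) e) (⊗-cancel-invˡ h g′))
    into : ∀ {g} → g ∈ gauges → h ⊗ g ∈ gauges
    into g∈ = gauges-complete (admissible-⊗ h _ h-adm (gauges-sound g∈))
    onto : ∀ {g} → g ∈ gauges → ∃ λ g′ → g′ ∈ gauges × h ⊗ g′ ≡ g
    onto {g} g∈ = gauge-inv h ⊗ g ,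
      gauges-complete (admissible-⊗ (gauge-inv h) g (admissible-inv h h-adm) (gauges-sound g∈)) ,
      ⊗-cancel-invʳ h g

  -- The shared random index r picks the r-th admissible gauge; the list is
  -- nonempty since it contains the identity gauge.
  rsr-via : ∀ L → L ≡ gauges → RandomSelfReducible _≟Perm_ f
  rsr-via [] L≡gauges =
    contradiction (subst (gauge-id ∈_) (sym L≡gauges) (gauges-complete (admissible-id {j}))) λ ()
  rsr-via L@(_ ∷ gs) L≡gauges = length gs , π , λ z x fx≡z → stays-in-fibre x fx≡z , uniform x z
    where
    π : Fin j → Perm N → Fin (length L) → Perm N
    π i a r = actOn (List.lookup L r) i a

    hits≡hitCount : ∀ x y → hits _≟Perm_ π x y ≡ hitCount gauges x y
    hits≡hitCount x y = trans (count-tabulate (hit? x y) (List.lookup L) id)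
      (cong (λ L′ → hitCount L′ x y) (trans (tabulate-lookup L) L≡gauges))

    stays-in-fibre : ∀ {z} x → f x ≡ z → ∀ r → f (act (List.lookup L r) x) ≡ z
    stays-in-fibre x fx≡z r = trans (f-respects (act g x) x (colour-invariant g x g-adm)) fx≡z
      where
      g = List.lookup L r
      g-adm = gauges-sound (subst (g ∈_) L≡gauges (∈-lookup r))

    uniform : ∀ x z y y′ → f y ≡ z → f y′ ≡ z → hits _≟Perm_ π x y ≡ hits _≟Perm_ π x y′
    uniform x z y y′ fy≡z fy′≡z = begin
      hits _≟Perm_ π x y   ≡⟨ hits≡hitCount x y ⟩
      hitCount gauges x y  ≡⟨ hitCount-uniform x y y′ (trans fy≡z (sym fy′≡z)) ⟩
      hitCount gauges x y′ ≡⟨ hits≡hitCount x y′ ⟨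
      hits _≟Perm_ π x y′  ∎
      where open ≡-Reasoning

  colour-rsr : RandomSelfReducible _≟Perm_ f
  colour-rsr = rsr-via gauges refl

isLow : ∀ {N} → ℕ → Fin N → Bool
isLow k c = does (toℕ c <? k)

isLow-true : ∀ {N k} {c : Fin N} → toℕ c < k → isLow k c ≡ true
isLow-true {k = k} {c} = dec-true (toℕ c <? k)

isLow-false : ∀ {N k} {c : Fin N} → ¬ toℕ c < k → isLow k c ≡ false
isLow-false {k = k} {c} = dec-false (toℕ c <? k)

pointer : ∀ k (k≥1 : 1 ≤ k) → Vec (Perm (2 * k)) k → Fin (2 * k)
pointer k k≥1 xs = compose xs (one k k≥1)

Jump-isLow : ∀ k (k≥1 : 1 ≤ k) xs → Jump k k≥1 xs ≡ not (isLow k (pointer k k≥1 xs))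
Jump-isLow k k≥1 xs with toℕ (pointer k k≥1 xs) <? k
... | yes low = cong not (sym (isLow-true low))
... | no ¬low = cong not (sym (isLow-false ¬low))

opposite-sum : ∀ k (c : Fin (2 * k)) → toℕ (opposite c) + suc (toℕ c) ≡ k + k
opposite-sum k c = begin
  toℕ (opposite c) + suc (toℕ c)       ≡⟨ cong (_+ suc (toℕ c)) (FinP.opposite-prop c) ⟩
  (2 * k ∸ suc (toℕ c)) + suc (toℕ c)  ≡⟨ ℕP.m∸n+n≡m (FinP.toℕ<n c) ⟩
  2 * k                                ≡⟨ cong (k +_) (ℕP.+-identityʳ k) ⟩
  k + k                                ∎
  where open ≡-Reasoning

isLow-opposite : ∀ k (c : Fin (2 * k)) → isLow k (opposite c) ≡ not (isLow k c)
isLow-opposite k c with toℕ c <? k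
... | yes c<k = trans (isLow-false both-low) (cong not (sym (isLow-true c<k)))
  where
  both-low : ¬ toℕ (opposite c) < k
  both-low c′<k = ℕP.<-irrefl (opposite-sum k c) (ℕP.+-mono-<-≤ c′<k c<k)
... | no c≮k = trans (isLow-true (ℕP.≰⇒> both-high)) (cong not (sym (isLow-false c≮k)))
  where
  both-high : ¬ k ≤ toℕ (opposite c)
  both-high k≤c′ = ℕP.<⇒≱ (ℕP.+-monoʳ-< k (ℕP.n<1+n k)) (begin
    k + suc k                       ≤⟨ ℕP.+-mono-≤ k≤c′ (s≤s (ℕP.≮⇒≥ c≮k)) ⟩
    toℕ (opposite c) + suc (toℕ c)  ≡⟨ opposite-sum k c ⟩
    k + k                           ∎)
    where open ℕP.≤-Reasoning

-- AND_k ≤ Jump_k: player i moves the pointer from i to i + 1 iff her bit is 1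

andUpTo : ∀ {m} → Vec Bool m → ℕ → Bool
andUpTo bs zero = true
andUpTo [] (suc i) = true
andUpTo (b ∷ bs) (suc i) = b ∧ andUpTo bs i

andUpTo-suc : ∀ {m} (bs : Vec Bool m) (i : Fin m) →
  andUpTo bs (suc (toℕ i)) ≡ andUpTo bs (toℕ i) ∧ lookup bs i
andUpTo-suc (b ∷ bs) Fin.zero = ∧-identityʳ b
andUpTo-suc (b ∷ bs) (Fin.suc i) = trans (cong (b ∧_) (andUpTo-suc bs i)) (sym (∧-assoc b _ _))

andUpTo-all : ∀ {m} (bs : Vec Bool m) → andUpTo bs m ≡ AND m bs
andUpTo-all [] = refl
andUpTo-all (b ∷ bs) = cong (b ∧_) (andUpTo-all bs)

-- Reached alive c i: after i players the pointer c is at position i if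
-- all their bits were 1 (alive), and below i otherwise.
Reached : Bool → ℕ → ℕ → Set
Reached true c i = c ≡ i
Reached false c i = c < i

reached-isLow : ∀ {N k} alive (c : Fin N) → Reached alive (toℕ c) k → isLow k c ≡ not alive
reached-isLow true c c≡k = isLow-false (ℕP.<-irrefl c≡k)
reached-isLow false c c<k = isLow-true c<k

module ANDWalk {N k : ℕ} (k<N : k < N) where

  pos : Fin (suc k) → Fin N
  pos j = inject≤ j k<N

  gate : Fin k → Bool → Perm N
  gate i true = swap (pos (inject₁ i)) (pos (Fin.suc i))
  gate i false = idP

  toℕ-pos : ∀ j → toℕ (pos j) ≡ toℕ j
  toℕ-pos j = FinP.toℕ-inject≤ j k<N

  toℕ-here : ∀ i → toℕ (pos (inject₁ i)) ≡ toℕ i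
  toℕ-here i = trans (toℕ-pos (inject₁ i)) (FinP.toℕ-inject₁ i)

  gate-fixes-below : ∀ i b c → toℕ c < toℕ i → apply (gate i b) c ≡ c
  gate-fixes-below i true c c<i = swap-other _ _ c
    (λ c≡i → ℕP.<-irrefl (trans (cong toℕ c≡i) (toℕ-here i)) c<i)
    (λ c≡i+1 → ℕP.<-asym c<i (ℕP.≤-reflexive (sym (trans (cong toℕ c≡i+1) (toℕ-pos _)))))
  gate-fixes-below i false c c<i = apply-id c

  gate-moves : ∀ i c → toℕ c ≡ toℕ i → toℕ (apply (gate i true) c) ≡ suc (toℕ i)
  gate-moves i c c≡i with FinP.toℕ-injective {i = c} {j = pos (inject₁ i)} (trans c≡i (sym (toℕ-here i)))
  ... | refl = trans (cong toℕ (swap-left _ _)) (toℕ-pos (Fin.suc i))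

  -- The two bits give different permutations: only bit 1 moves position i.
  gate-injective : ∀ i → Injective _≡_ _≡_ (gate i)
  gate-injective i {true} {true} _ = refl
  gate-injective i {false} {false} _ = refl
  gate-injective i {true} {false} e = contradiction (begin
    suc (toℕ i)                   ≡⟨ gate-moves i cᵢ (toℕ-here i) ⟨
    toℕ (apply (gate i true) cᵢ)  ≡⟨ cong (λ p → toℕ (apply p cᵢ)) e ⟩
    toℕ (apply idP cᵢ)            ≡⟨ cong toℕ (apply-id cᵢ) ⟩
    toℕ cᵢ                        ≡⟨ toℕ-here i ⟩
    toℕ i                         ∎) ℕP.1+n≢n
    where
    open ≡-Reasoning
    cᵢ = pos (inject₁ i)
  gate-injective i {false} {true} e = sym (gate-injective i (sym e))

  gate-step : ∀ alive b i c → Reached alive (toℕ c) (toℕ i) →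
    Reached (alive ∧ b) (toℕ (apply (gate i b) c)) (suc (toℕ i))
  gate-step true true i c c≡i = gate-moves i c c≡i
  gate-step true false i c c≡i = s≤s (ℕP.≤-reflexive (trans (cong toℕ (apply-id c)) c≡i))
  gate-step false b i c c<i =
    subst (_< suc (toℕ i)) (cong toℕ (sym (gate-fixes-below i b c c<i))) (ℕP.m<n⇒m<1+n c<i)

  walk : ∀ bs (start : Fin N) → toℕ start ≡ 0 →
    Reached (AND k bs) (toℕ (compose (applyEach gate bs) start)) k
  walk bs start at-0 = subst (λ alive → Reached alive end k) (andUpTo-all bs)
    (compose-induction (λ i c → Reached (andUpTo bs i) (toℕ c) i) (applyEach gate bs) at-0 step)
    where
    end = toℕ (compose (applyEach gate bs) start)
    step : ∀ i {c} → Reached (andUpTo bs (toℕ i)) (toℕ c) (toℕ i) →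
      Reached (andUpTo bs (suc (toℕ i))) (toℕ (apply (lookup (applyEach gate bs) i) c)) (suc (toℕ i))
    step i {c} reached rewrite andUpTo-suc bs i | lookup∘tabulate (λ j → gate j (lookup bs j)) i =
      gate-step _ (lookup bs i) i c reached

AND-≼-Jump : ∀ k (k≥1 : 1 ≤ k) → AND k ≼ Jump k k≥1
AND-≼-Jump (suc m) k≥1 = gate , gate-injective , AND-is-Jump
  where
  k = suc m
  open ANDWalk (ℕP.m<m+n k {k + 0} (s≤s z≤n))
  AND-is-Jump : ∀ bs → AND k bs ≡ Jump k k≥1 (applyEach gate bs)
  AND-is-Jump bs = begin
    AND k bs                        ≡⟨ not-involutive (AND k bs) ⟨
    not (not (AND k bs))            ≡⟨ cong not (reached-isLow (AND k bs) p (walk bs (one k k≥1) refl)) ⟨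
    not (isLow k p)                 ≡⟨ Jump-isLow k k≥1 (applyEach gate bs) ⟨
    Jump k k≥1 (applyEach gate bs)  ∎
    where
    open ≡-Reasoning
    p = pointer k k≥1 (applyEach gate bs)

-- Jump_k is flippable: the last player also reverses [2k]

reversal : ∀ {n} → Perm n
reversal = mkPerm opposite λ i j e →
  trans (sym (FinP.opposite-involutive i)) (trans (cong opposite e) (FinP.opposite-involutive j))

Jump-flippable : ∀ k (k≥1 : 1 ≤ k) → Flippable (Jump k k≥1)
Jump-flippable (suc m) k≥1 = flip , flip-injective , flip-negates
  where
  k = suc m
  flip : Fin k → Perm (2 * k) → Perm (2 * k)
  flip = onLast (reversal ∙_)

  flip-injective : ∀ i → Injective _≡_ _≡_ (flip i)
  flip-injective = onLast-injective (∙-cancelˡ reversal)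

  flip-negates : ∀ xs → not (Jump k k≥1 xs) ≡ Jump k k≥1 (applyEach flip xs)
  flip-negates xs = begin
    not (Jump k k≥1 xs)                                ≡⟨ cong not (Jump-isLow k k≥1 xs) ⟩
    not (not (isLow k p))                              ≡⟨ cong not (isLow-opposite k p) ⟨
    not (isLow k (opposite p))                         ≡⟨ cong (not ∘ isLow k) (lookup∘tabulate opposite p) ⟨
    not (isLow k (apply reversal p))                   ≡⟨ cong (not ∘ isLow k) (compose-onLast reversal xs o) ⟨
    not (isLow k (pointer k k≥1 (applyEach flip xs)))  ≡⟨ Jump-isLow k k≥1 (applyEach flip xs) ⟨
    Jump k k≥1 (applyEach flip xs)                     ∎
    where
    open ≡-Reasoning
    o = one k k≥1
    p = pointer k k≥1 xs

-- Jump_k is random self-reducible, being a function of the colour isLow k of the pointer.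
Jump-rsr : ∀ k (k≥1 : 1 ≤ k) → RandomSelfReducible _≟Perm_ (Jump k k≥1)
Jump-rsr k k≥1 = ColourRSR.colour-rsr (isLow k) (one k k≥1) (Jump k k≥1) respects reflects
  where
  respects : ∀ x y → isLow k (pointer k k≥1 x) ≡ isLow k (pointer k k≥1 y) → Jump k k≥1 x ≡ Jump k k≥1 y
  respects x y same = trans (Jump-isLow k k≥1 x) (trans (cong not same) (sym (Jump-isLow k k≥1 y)))
  reflects : ∀ x y → Jump k k≥1 x ≡ Jump k k≥1 y → isLow k (pointer k k≥1 x) ≡ isLow k (pointer k k≥1 y)
  reflects x y same = not-injective (trans (sym (Jump-isLow k k≥1 x)) (trans same (Jump-isLow k k≥1 y)))

lemma3 : ∀ (k : ℕ) (k≥1 : 1 ≤ k) → Versatile (_≟Perm_ {2 * k}) (Jump k k≥1)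
lemma3 k k≥1 = AND-≼-Jump k k≥1 , Jump-flippable k k≥1 , Jump-rsr k k≥1
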